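{- Let $s$ be a positive integer and $g:\mathbb{Z}_{\ge0}\to\mathbb{Z}_{\ge0}$ nondecreasing such that $G_g(\{y,z\})=(y\oplus(z+s))-s$ for all $y,z\in\mathbb{Z}_{\ge0}$ with $y\le g(z)$. Then $i\oplus s=i+s$ for $i=0,1,2,\dots,g(0)$.
   Context: $\oplus$ denotes nim-sum (bitwise XOR). Positions of the chocolate bar game $CB(g,y,z)$ are pairs $\{y,z\}$ with $y\le g(z)$ (bar with $z+1$ columns, column 0 bitter, column $i$ of height $\min(g(i),y)+1$). Moves: $move_g(\{y,z\})=\{\{v,z\}:v<y\}\cup\{\{\min(y,g(w)),w\}:w<z\}$. Grundy number: $G_g(\{y,z\})=\mathrm{mex}\{G_g(p):p\in move_g(\{y,z\})\}$, mex being the least nonnegative integer not in the set. -}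

module Defs where

open import Data.Nat using (ℕ; zero; suc; _+_; _*_; _⊓_; _≟_)
open import Data.Nat.DivMod using (_/_; _%_)
open import Data.List using (List; []; _∷_; _++_; map; length; zip; upTo)
open import Data.List.Membership.DecPropositional _≟_ using (_∈?_)
open import Data.Product using (_×_; _,_)
open import Relation.Nullary using (yes; no)

-- Nim-sum (bitwise XOR) of natural numbers.  The fuel argument only
-- bounds the recursion depth; m + n steps are always enough.
xorFuel : ℕ → ℕ → ℕ → ℕ
xorFuel zero    m n = 0
xorFuel (suc f) m n = bit (m % 2) (n % 2) + 2 * xorFuel f (m / 2) (n / 2)
  where
  bit : ℕ → ℕ → ℕ
  bit zero    zero    = 0
  bit zero    (suc _) = 1
  bit (suc _) zero    = 1
  bit (suc _) (suc _) = 0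

infixl 6 _⊕_
_⊕_ : ℕ → ℕ → ℕ
m ⊕ n = xorFuel (m + n) m n

-- mex: least nonnegative integer not in the list
-- (it is at most the length of the list, so that much fuel suffices).
mexFrom : ℕ → ℕ → List ℕ → ℕ
mexFrom zero    k l = k
mexFrom (suc f) k l with k ∈? l
... | yes _ = mexFrom f (suc k) l
... | no  _ = k

mex : List ℕ → ℕ
mex l = mexFrom (length l) 0 l

module Grundy (g : ℕ → ℕ) where

  -- A "column table" for columns 0..z-1: the list of functions
  -- y ↦ G_g({y,w}) for w = 0,…,z-1 (in this order).

  sideOpts : List (ℕ → ℕ) → ℕ → List ℕ
  sideOpts prev y =
    map (λ { (w , c) → c (y ⊓ g w) }) (zip (upTo (length prev)) prev)

  -- below prev y = [G({0,z}), …, G({y-1,z})], where prev is the table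
  -- for columns 0..z-1.
  below : List (ℕ → ℕ) → ℕ → List ℕ
  below prev zero    = []
  below prev (suc y) =
    below prev y ++ (mex (below prev y ++ sideOpts prev y) ∷ [])

  -- G({y,z}) given the table for columns 0..z-1:
  -- mex of the Grundy values of {v,z} (v<y) and {min(y,g w),w} (w<z).
  col : List (ℕ → ℕ) → ℕ → ℕ
  col prev y = mex (below prev y ++ sideOpts prev y)

  cols : ℕ → List (ℕ → ℕ)
  cols zero    = []
  cols (suc z) = cols z ++ (col (cols z) ∷ [])

  G : ℕ → ℕ → ℕ
  G y z = col (cols z) y

G_ : (g : ℕ → ℕ) → ℕ → ℕ → ℕ
G_ g = Grundy.G g

Nondecreasing : (ℕ → ℕ) → Set
Nondecreasing g = ∀ a b → a Data.Nat.≤ b → g a Data.Nat.≤ g b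

-- Column 0 has no side moves, so the position {y,0} is a single Nim heap of
-- size y and G_g({y,0}) = y.  The hypothesis at z = 0 then reads
-- i + s = i ⊕ s for every i ≤ g(0).
module Submission where

open import Defs
open import Data.Nat using (ℕ; zero; suc; _+_; _≤_; _<_; _≟_; z<s)
open import Data.Nat.Properties using (+-identityʳ; +-suc; m<m+n)
open import Data.List using ([]; upTo)
open import Data.List.Properties using (++-identityʳ; length-upTo; upTo-∷ʳ)
open import Data.List.Membership.DecPropositional _≟_ using (_∈?_)
open import Data.List.Membership.Propositional.Properties using (∈-upTo⁺)
open import Relation.Nullary using (yes; no; contradiction)
open import Relation.Binary.PropositionalEquality
  using (_≡_; refl; sym; trans; subst; cong; module ≡-Reasoning)

mexFrom-upTo : ∀ f k n → k + f ≡ n → mexFrom f k (upTo n) ≡ n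
mexFrom-upTo zero    k n k+0≡n = trans (sym (+-identityʳ k)) k+0≡n
mexFrom-upTo (suc f) k n k+1+f≡n with k ∈? upTo n
... | yes _  = mexFrom-upTo f (suc k) n (trans (sym (+-suc k f)) k+1+f≡n)
... | no k∉n = contradiction (∈-upTo⁺ (subst (k <_) k+1+f≡n (m<m+n k z<s))) k∉n

mex-upTo : ∀ n → mex (upTo n) ≡ n
mex-upTo n = subst (λ f → mexFrom f 0 (upTo n) ≡ n) (sym (length-upTo n))
                   (mexFrom-upTo n 0 n refl)

module _ (g : ℕ → ℕ) where
  open Grundy g using (below)

  below-column0 : ∀ y → below [] y ≡ upTo y
  below-column0 zero    = refl
  below-column0 (suc y)
    rewrite below-column0 y | ++-identityʳ (upTo y) | mex-upTo y = upTo-∷ʳ y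

  G-column0 : ∀ y → G_ g y 0 ≡ y
  G-column0 y rewrite below-column0 y | ++-identityʳ (upTo y) = mex-upTo y

mainTheorem20 : (s : ℕ) → 1 ≤ s → (g : ℕ → ℕ) → Nondecreasing g →
    (∀ y z → y ≤ g z → G_ g y z + s ≡ y ⊕ (z + s)) →
    ∀ i → i ≤ g 0 → i ⊕ s ≡ i + s
mainTheorem20 s _ g _ grundyFormula i i≤g0 = begin
  i ⊕ s          ≡⟨ sym (grundyFormula i 0 i≤g0) ⟩
  G_ g i 0 + s   ≡⟨ cong (_+ s) (G-column0 g i) ⟩
  i + s          ∎
  where open ≡-Reasoning
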